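{- Let $(a_n)_{n\geq 0}$ be the Thue–Morse sequence and, for an integer $b\geq2$, let $\xi_b=\sum_{n=0}^{+\infty}a_n/b^n$. Then for every integer $b\geq 2$, the irrationality measure of $\xi_b$ satisfies $\mu(\xi_b)\leq 5$.
   Context: The Thue–Morse sequence $(a_n)_{n\geq0}$ is defined by $a_n=0$ if the sum of the binary digits of $n$ is even and $a_n=1$ otherwise; it is the fixed point beginning with $0$ of the morphism $0\mapsto 01$, $1\mapsto 10$. The irrationality measure $\mu(\xi)$ is the supremum of the real $\tau>0$ for which $|\xi-p/q|<q^{ -\tau}$ has infinitely many solutions with $p,q$ coprime integers. -}

module Defs where

open import Data.Nat as ℕ using (ℕ; zero; suc)
open import Data.Nat.Properties using (m^n≢0)
open import Data.Integer as ℤ using (ℤ; +_)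
open import Data.Rational as ℚ using (ℚ; 0ℚ; 1ℚ; _+_; _*_; _-_; ∣_∣; _<_)

-- Sum of binary digits of n, computed with a fuel argument
-- (fuel n suffices, since n < 2^n).
digitSumFuel : ℕ → ℕ → ℕ
digitSumFuel zero    n = 0
digitSumFuel (suc f) n = n ℕ.% 2 ℕ.+ digitSumFuel f (n ℕ./ 2)

binDigitSum : ℕ → ℕ
binDigitSum n = digitSumFuel n n

thueMorse : ℕ → ℕ
thueMorse n = binDigitSum n ℕ.% 2

-- 1 / b^n as a rational (b = 0 is irrelevant; it is given a dummy value 0).
invPow : ℕ → ℕ → ℚ
invPow zero    n = 0ℚ
invPow (suc k) n = (+ 1) ℚ./ (suc k ℕ.^ n)
  where instance _ = m^n≢0 (suc k) n

partialSum : ℕ → ℕ → ℚ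
partialSum b zero    = 0ℚ
partialSum b (suc N) = partialSum b N + (+ thueMorse N) ℚ./ 1 * invPow b N

-- Tail bound  T_b(N) = Σ_{n≥N} 1/b^n = b / ((b-1) b^N), for b ≥ 2.
-- Since 0 ≤ a_n ≤ 1, |ξ_b - S_b(N)| ≤ T_b(N), and T_b(N) → 0.
tailBound : ℕ → ℕ → ℚ
tailBound zero          N = 0ℚ
tailBound (suc zero)    N = 0ℚ
tailBound (suc (suc c)) N = (+ (suc (suc c))) ℚ./ (suc c) * invPow (suc (suc c)) N

powℚ : ℚ → ℕ → ℚ
powℚ x zero    = 1ℚ
powℚ x (suc k) = x * powℚ x k

frac : ℤ → ℕ → ℚ
frac p zero    = 0ℚ
frac p (suc k) = p ℚ./ suc k

-- "|ξ_b - p/q| < q^{-r/s}", where ξ_b = Σ_{n≥0} a_n / b^n is the real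
-- number given as the limit of partialSum b.  For a real c > 0 one has
-- |ξ_b - x| < c  iff  ∃ N, |S_b(N) - x| + T_b(N) < c, and raising to the
-- s-th power (s ≥ 1) this is  ∃ N, (|S_b(N) - x| + T_b(N))^s · q^r < 1.
CloseApprox : (b r s : ℕ) → ℤ → ℕ → Set
CloseApprox b r s p q =
  ∃ λ N → powℚ (∣ partialSum b N - frac p q ∣ + tailBound b N) s * ((+ (q ℕ.^ r)) ℚ./ 1) < 1ℚ
  where open import Data.Product using (∃)

-- Cut the Thue–Morse word into blocks of length 2^k: it begins A B B A B A A B …, where A is its
-- prefix of length 2^k and B the complement of A, and the blocks of the next stage are A B and B A.
-- Replacing everything after the sixth block by (B A)^ω gives a rational ρ_k with denominator
-- O(H³), H = b^(2^k), lying within 4/H⁶ of ξ_b; consecutive ρ_k differ, and H squares from one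
-- stage to the next. For p/q close to ξ_b take the first stage with 8qb ≤ H³: p/q differs from ρ_k
-- or ρ_(k+1), and 1/(q·den ρ) ≤ |p/q − ρ| ≤ |p/q − ξ_b| + 4/H⁶ forces q^r < (K q⁵)^s, which
-- bounds q as soon as r > 5s.
module Submission where

open import Data.Nat.Base as ℕ using (ℕ; zero; suc; NonZero)
open import Relation.Binary.PropositionalEquality

module Fraction where

  open import Data.Nat.Properties using (m*n≢0)
  open import Data.Nat.Tactic.RingSolver using (solve-∀)
  open import Data.Integer.Base as ℤ using (ℤ; +_)
  import Data.Integer.Properties as ℤ
  open import Data.Rational.Base hiding (NonZero)
  open import Data.Rational.Properties
  open import Data.Rational.Unnormalised.Base as ᵘ using (*≡*; *≤*; *<*)
  import Data.Rational.Unnormalised.Properties as ᵘ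

  private
    toℚᵘ-/ : ∀ i n .{{_ : NonZero n}} → toℚᵘ (i / n) ᵘ.≃ i ᵘ./ n
    toℚᵘ-/ i (suc n) = toℚᵘ-fromℚᵘ (ᵘ.mkℚᵘ i n)

  /-≡ : ∀ i j m n .{{_ : NonZero m}} .{{_ : NonZero n}} →
        i ℤ.* + n ≡ j ℤ.* + m → i / m ≡ j / n
  /-≡ i j (suc m) (suc n) eq =
    toℚᵘ-injective (ᵘ.≃-trans (toℚᵘ-/ i _) (ᵘ.≃-trans (*≡* eq) (ᵘ.≃-sym (toℚᵘ-/ j _))))

  /-≡⁻¹ : ∀ i j m n .{{_ : NonZero m}} .{{_ : NonZero n}} →
          i / m ≡ j / n → i ℤ.* + n ≡ j ℤ.* + m
  /-≡⁻¹ i j (suc m) (suc n) eq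
    with *≡* eq′ ← ᵘ.≃-trans (ᵘ.≃-sym (toℚᵘ-/ i _)) (ᵘ.≃-trans (toℚᵘ-cong eq) (toℚᵘ-/ j _))
    = eq′

  /-≤ : ∀ i j m n .{{_ : NonZero m}} .{{_ : NonZero n}} →
        i ℤ.* + n ℤ.≤ j ℤ.* + m → i / m ≤ j / n
  /-≤ i j (suc m) (suc n) le = toℚᵘ-cancel-≤
    (ᵘ.≤-respˡ-≃ (ᵘ.≃-sym (toℚᵘ-/ i _)) (ᵘ.≤-respʳ-≃ (ᵘ.≃-sym (toℚᵘ-/ j _)) (*≤* le)))

  /-<⁻¹ : ∀ i j m n .{{_ : NonZero m}} .{{_ : NonZero n}} →
          i / m < j / n → i ℤ.* + n ℤ.< j ℤ.* + m
  /-<⁻¹ i j (suc m) (suc n) lt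
    with *<* lt′ ← ᵘ.<-respˡ-≃ (toℚᵘ-/ i _) (ᵘ.<-respʳ-≃ (toℚᵘ-/ j _) (toℚᵘ-mono-< lt))
    = lt′

  /-+ : ∀ i j m n .{{_ : NonZero m}} .{{_ : NonZero n}} →
        i / m + j / n ≡ ((i ℤ.* + n ℤ.+ j ℤ.* + m) / (m ℕ.* n)) {{m*n≢0 m n}}
  /-+ i j (suc m) (suc n) = toℚᵘ-injective (ᵘ.≃-trans (toℚᵘ-homo-+ (i / suc m) (j / suc n))
    (ᵘ.≃-trans (ᵘ.+-cong (toℚᵘ-/ i (suc m)) (toℚᵘ-/ j (suc n)))
               (ᵘ.≃-sym (toℚᵘ-/ (i ℤ.* + suc n ℤ.+ j ℤ.* + suc m) (suc m ℕ.* suc n) {{ℕ.nonZero}}))))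

  /-* : ∀ i j m n .{{_ : NonZero m}} .{{_ : NonZero n}} →
        (i / m) * (j / n) ≡ ((i ℤ.* j) / (m ℕ.* n)) {{m*n≢0 m n}}
  /-* i j (suc m) (suc n) = toℚᵘ-injective (ᵘ.≃-trans (toℚᵘ-homo-* (i / suc m) (j / suc n))
    (ᵘ.≃-trans (ᵘ.*-cong (toℚᵘ-/ i (suc m)) (toℚᵘ-/ j (suc n)))
               (ᵘ.≃-sym (toℚᵘ-/ (i ℤ.* j) (suc m ℕ.* suc n) {{ℕ.nonZero}}))))

  -‿/ : ∀ i n .{{_ : NonZero n}} → - (i / n) ≡ (ℤ.- i) / n
  -‿/ i (suc n) = toℚᵘ-injective (ᵘ.≃-trans (toℚᵘ-homo‿- (i / suc n))
    (ᵘ.≃-trans (ᵘ.-‿cong (toℚᵘ-/ i (suc n))) (ᵘ.≃-sym (toℚᵘ-/ (ℤ.- i) (suc n)))))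

  ∣/∣ : ∀ i n .{{_ : NonZero n}} → ∣ i / n ∣ ≡ (+ ℤ.∣ i ∣) / n
  ∣/∣ i (suc n) = toℚᵘ-injective (ᵘ.≃-trans (toℚᵘ-homo-∣-∣ (i / suc n))
    (ᵘ.≃-trans (ᵘ.∣-∣-cong (toℚᵘ-/ i (suc n))) (ᵘ.≃-sym (toℚᵘ-/ (+ ℤ.∣ i ∣) (suc n)))))

  infixl 7 _/ₙ_

  _/ₙ_ : ℕ → (n : ℕ) .{{_ : NonZero n}} → ℚ
  a /ₙ n = + a / n

  /ₙ-≡ : ∀ a c m n .{{_ : NonZero m}} .{{_ : NonZero n}} →
         a ℕ.* n ≡ c ℕ.* m → a /ₙ m ≡ c /ₙ n
  /ₙ-≡ a c m n eq =
    /-≡ (+ a) (+ c) m n (trans (sym (ℤ.pos-* a n)) (trans (cong +_ eq) (ℤ.pos-* c m)))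

  /ₙ-≡⁻¹ : ∀ a c m n .{{_ : NonZero m}} .{{_ : NonZero n}} →
           a /ₙ m ≡ c /ₙ n → a ℕ.* n ≡ c ℕ.* m
  /ₙ-≡⁻¹ a c m n eq =
    ℤ.+-injective (trans (ℤ.pos-* a n) (trans (/-≡⁻¹ (+ a) (+ c) m n eq) (sym (ℤ.pos-* c m))))

  /ₙ-≤ : ∀ a c m n .{{_ : NonZero m}} .{{_ : NonZero n}} →
         a ℕ.* n ℕ.≤ c ℕ.* m → a /ₙ m ≤ c /ₙ n
  /ₙ-≤ a c m n le = /-≤ (+ a) (+ c) m n (subst₂ ℤ._≤_ (ℤ.pos-* a n) (ℤ.pos-* c m) (ℤ.+≤+ le))

  /ₙ-<⁻¹ : ∀ a c m n .{{_ : NonZero m}} .{{_ : NonZero n}} →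
           a /ₙ m < c /ₙ n → a ℕ.* n ℕ.< c ℕ.* m
  /ₙ-<⁻¹ a c m n lt =
    ℤ.drop‿+<+ (subst₂ ℤ._<_ (sym (ℤ.pos-* a n)) (sym (ℤ.pos-* c m)) (/-<⁻¹ (+ a) (+ c) m n lt))

  /ₙ-+ : ∀ a c m n .{{_ : NonZero m}} .{{_ : NonZero n}} →
         a /ₙ m + c /ₙ n ≡ ((a ℕ.* n ℕ.+ c ℕ.* m) /ₙ (m ℕ.* n)) {{m*n≢0 m n}}
  /ₙ-+ a c m n = trans (/-+ (+ a) (+ c) m n) (cong (λ x → (x / (m ℕ.* n)) {{m*n≢0 m n}})
    (trans (cong₂ ℤ._+_ (sym (ℤ.pos-* a n)) (sym (ℤ.pos-* c m))) (sym (ℤ.pos-+ (a ℕ.* n) (c ℕ.* m)))))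

  /ₙ-* : ∀ a c m n .{{_ : NonZero m}} .{{_ : NonZero n}} →
         (a /ₙ m) * (c /ₙ n) ≡ ((a ℕ.* c) /ₙ (m ℕ.* n)) {{m*n≢0 m n}}
  /ₙ-* a c m n =
    trans (/-* (+ a) (+ c) m n) (cong (λ x → (x / (m ℕ.* n)) {{m*n≢0 m n}}) (sym (ℤ.pos-* a c)))

  /ₙ-+-≡ : ∀ a c x m n l .{{_ : NonZero m}} .{{_ : NonZero n}} .{{_ : NonZero l}} →
           (a ℕ.* n ℕ.+ c ℕ.* m) ℕ.* l ≡ x ℕ.* (m ℕ.* n) → a /ₙ m + c /ₙ n ≡ x /ₙ l
  /ₙ-+-≡ a c x m n l eq =
    trans (/ₙ-+ a c m n) (/ₙ-≡ (a ℕ.* n ℕ.+ c ℕ.* m) x (m ℕ.* n) l {{m*n≢0 m n}} eq)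

  /ₙ-+-same : ∀ a c m .{{_ : NonZero m}} → a /ₙ m + c /ₙ m ≡ (a ℕ.+ c) /ₙ m
  /ₙ-+-same a c m = /ₙ-+-≡ a c (a ℕ.+ c) m m m (regroup a c m)
    where
    regroup : ∀ a c m → (a ℕ.* m ℕ.+ c ℕ.* m) ℕ.* m ≡ (a ℕ.+ c) ℕ.* (m ℕ.* m)
    regroup = solve-∀

module BinaryDigitSum where

  open import Data.Nat.Base
  open import Data.Nat.Properties
  open import Data.Nat.DivMod
  open import Data.Nat.Tactic.RingSolver using (solve-∀)
  open import Defs using (digitSumFuel; binDigitSum; thueMorse)
  open ≡-Reasoning

  digitSumFuel-0 : ∀ f → digitSumFuel f 0 ≡ 0
  digitSumFuel-0 zero    = refl
  digitSumFuel-0 (suc f) = digitSumFuel-0 f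

  private
    half≤ : ∀ {n f} → n ≤ suc f → n / 2 ≤ f
    half≤ {n} {f} n≤1+f = ≤-pred (m<n*o⇒m/o<n (≤-<-trans n≤1+f (m<m*n (suc f) 2 ≤-refl)))

  digitSumFuel-stable : ∀ {f g n} → n ≤ f → n ≤ g → digitSumFuel f n ≡ digitSumFuel g n
  digitSumFuel-stable {zero}  {g}     z≤n _   = sym (digitSumFuel-0 g)
  digitSumFuel-stable {suc f} {zero}  _   z≤n = digitSumFuel-0 (suc f)
  digitSumFuel-stable {suc f} {suc g} {n} n≤f n≤g =
    cong (n % 2 +_) (digitSumFuel-stable (half≤ n≤f) (half≤ n≤g))

  binDigitSum-unfold : ∀ n → binDigitSum n ≡ n % 2 + binDigitSum (n / 2)
  binDigitSum-unfold zero    = refl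
  binDigitSum-unfold (suc n) = cong (suc n % 2 +_) (digitSumFuel-stable {n} (half≤ ≤-refl) ≤-refl)

  binDigitSum-bit : ∀ {r} m → r < 2 → binDigitSum (r + m * 2) ≡ r + binDigitSum m
  binDigitSum-bit {r} m r<2 = begin
    binDigitSum (r + m * 2)                          ≡⟨ binDigitSum-unfold (r + m * 2) ⟩
    (r + m * 2) % 2 + binDigitSum ((r + m * 2) / 2)  ≡⟨ cong₂ (λ x y → x + binDigitSum y) last-bit rest ⟩
    r + binDigitSum m                                ∎
    where
    r%2≡r : r % 2 ≡ r
    r%2≡r = m<n⇒m%n≡m r<2
    last-bit : (r + m * 2) % 2 ≡ r
    last-bit = trans ([m+kn]%n≡m%n r m 2) r%2≡r
    no-carry : r % 2 + m * 2 % 2 < 2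
    no-carry = subst₂ (λ x y → x + y < 2) (sym r%2≡r) (sym (m*n%n≡0 m 2))
                      (subst (_< 2) (sym (+-identityʳ r)) r<2)
    rest : (r + m * 2) / 2 ≡ m
    rest = trans (+-distrib-/ r (m * 2) no-carry) (cong₂ _+_ (m<n⇒m/n≡0 r<2) (m*n/n≡m m 2))

  binDigitSum-block : ∀ k j {i} → i < 2 ^ k →
                      binDigitSum (j * 2 ^ k + i) ≡ binDigitSum j + binDigitSum i
  binDigitSum-block zero j {zero} _ = trans (cong binDigitSum (trans (+-identityʳ (j * 1)) (*-identityʳ j)))
                                            (sym (+-identityʳ (binDigitSum j)))
  binDigitSum-block zero j {suc _} (s≤s ())
  binDigitSum-block (suc k) j {i} i<2^[1+k] = begin
    binDigitSum (j * 2 ^ suc k + i)           ≡⟨ cong binDigitSum (shift i≡r+q*2) ⟩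
    binDigitSum (r + (j * 2 ^ k + q) * 2)     ≡⟨ binDigitSum-bit (j * 2 ^ k + q) r<2 ⟩
    r + binDigitSum (j * 2 ^ k + q)           ≡⟨ cong (r +_) (binDigitSum-block k j q<2^k) ⟩
    r + (binDigitSum j + binDigitSum q)       ≡⟨ +-comm-middle r (binDigitSum j) (binDigitSum q) ⟩
    binDigitSum j + (r + binDigitSum q)       ≡⟨ cong (binDigitSum j +_) (sym (binDigitSum-bit q r<2)) ⟩
    binDigitSum j + binDigitSum (r + q * 2)   ≡⟨ cong (λ x → binDigitSum j + binDigitSum x) (sym i≡r+q*2) ⟩
    binDigitSum j + binDigitSum i             ∎
    where
    r q : ℕ
    r = i % 2
    q = i / 2
    i≡r+q*2 : i ≡ r + q * 2
    i≡r+q*2 = m≡m%n+[m/n]*n i 2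
    r<2 : r < 2
    r<2 = m%n<n i 2
    q<2^k : q < 2 ^ k
    q<2^k = m<n*o⇒m/o<n (subst (i <_) (*-comm 2 (2 ^ k)) i<2^[1+k])
    shift : i ≡ r + q * 2 → j * 2 ^ suc k + i ≡ r + (j * 2 ^ k + q) * 2
    shift i≡ = trans (cong (j * 2 ^ suc k +_) i≡) (regroup j (2 ^ k) r q)
      where
      regroup : ∀ j p r q → j * (2 * p) + (r + q * 2) ≡ r + (j * p + q) * 2
      regroup = solve-∀
    +-comm-middle : ∀ x y z → x + (y + z) ≡ y + (x + z)
    +-comm-middle = solve-∀

  thueMorse-≤1 : ∀ n → thueMorse n ≤ 1
  thueMorse-≤1 n = ≤-pred (m%n<n (binDigitSum n) 2)

  thueMorse-block : ∀ k j {i} → i < 2 ^ k →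
                    thueMorse (j * 2 ^ k + i) ≡ (thueMorse j + thueMorse i) % 2
  thueMorse-block k j {i} i<2^k = begin
    binDigitSum (j * 2 ^ k + i) % 2               ≡⟨ cong (_% 2) (binDigitSum-block k j i<2^k) ⟩
    (binDigitSum j + binDigitSum i) % 2           ≡⟨ %-distribˡ-+ (binDigitSum j) (binDigitSum i) 2 ⟩
    (thueMorse j + thueMorse i) % 2               ∎

module Horner where

  open import Data.Nat.Base
  open import Data.Nat.Properties
  open import Data.Nat.Tactic.RingSolver using (solve-∀)
  open ≡-Reasoning

  horner : ℕ → (ℕ → ℕ) → ℕ → ℕ
  horner x f zero    = 0
  horner x f (suc n) = horner x f n * x + f n

  horner-cong : ∀ x {f g} n → (∀ {i} → i < n → f i ≡ g i) → horner x f n ≡ horner x g n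
  horner-cong x zero    f≗g = refl
  horner-cong x (suc n) f≗g =
    cong₂ (λ u v → u * x + v) (horner-cong x n (λ i<n → f≗g (m<n⇒m<1+n i<n))) (f≗g ≤-refl)

  horner-+ : ∀ x f g n → horner x f n + horner x g n ≡ horner x (λ i → f i + g i) n
  horner-+ x f g zero    = refl
  horner-+ x f g (suc n) = trans (regroup x (horner x f n) (horner x g n) (f n) (g n))
    (cong (λ u → u * x + (f n + g n)) (horner-+ x f g n))
    where
    regroup : ∀ x u v y z → u * x + y + (v * x + z) ≡ (u + v) * x + (y + z)
    regroup = solve-∀

  horner-++ : ∀ x f m n → horner x f (m + n) ≡ horner x f m * x ^ n + horner x (λ i → f (m + i)) n
  horner-++ x f m zero    =
    trans (cong (horner x f) (+-identityʳ m)) (sym (trans (+-identityʳ _) (*-identityʳ _)))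
  horner-++ x f m (suc n) = begin
    horner x f (m + suc n)                             ≡⟨ cong (horner x f) (+-suc m n) ⟩
    horner x f (m + n) * x + f (m + n)                 ≡⟨ cong (λ u → u * x + f (m + n)) (horner-++ x f m n) ⟩
    (horner x f m * x ^ n + tail) * x + f (m + n)      ≡⟨ regroup x (horner x f m) (x ^ n) tail (f (m + n)) ⟩
    horner x f m * x ^ suc n + (tail * x + f (m + n))  ∎
    where
    tail = horner x (λ i → f (m + i)) n
    regroup : ∀ x u p t y → (u * p + t) * x + y ≡ u * (x * p) + (t * x + y)
    regroup = solve-∀

  horner-blocks : ∀ x f h n →
                  horner x f (n * h) ≡ horner (x ^ h) (λ j → horner x (λ i → f (j * h + i)) h) n
  horner-blocks x f h zero    = refl
  horner-blocks x f h (suc n) = begin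
    horner x f (h + n * h)                ≡⟨ cong (horner x f) (+-comm h (n * h)) ⟩
    horner x f (n * h + h)                ≡⟨ horner-++ x f (n * h) h ⟩
    horner x f (n * h) * x ^ h + lastBlock ≡⟨ cong (λ u → u * x ^ h + lastBlock) (horner-blocks x f h n) ⟩
    horner (x ^ h) (λ j → horner x (λ i → f (j * h + i)) h) (suc n) ∎
    where
    lastBlock = horner x (λ i → f (n * h + i)) h

  horner-repunit : ∀ x .{{_ : NonZero x}} n → pred x * horner x (λ _ → 1) n + 1 ≡ x ^ n
  horner-repunit (suc e) zero    = cong (_+ 1) (*-zeroʳ e)
  horner-repunit (suc e) (suc n) = begin
    e * (horner (suc e) (λ _ → 1) n * suc e + 1) + 1  ≡⟨ regroup e (horner (suc e) (λ _ → 1) n) ⟩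
    suc e * (e * horner (suc e) (λ _ → 1) n + 1)      ≡⟨ cong (suc e *_) (horner-repunit (suc e) n) ⟩
    suc e * suc e ^ n                                 ∎
    where
    regroup : ∀ e r → e * (r * suc e + 1) + 1 ≡ suc e * (e * r + 1)
    regroup = solve-∀

module RationalFacts where

  open import Data.Rational.Base
  open import Data.Rational.Properties
  open import Data.Rational.Solver using (module +-*-Solver)
  open +-*-Solver
  open import Defs using (powℚ)

  p≤p+q : ∀ p {q} → 0ℚ ≤ q → p ≤ p + q
  p≤p+q p 0≤q = subst (_≤ p + _) (+-identityʳ p) (+-monoʳ-≤ p 0≤q)

  +-cancelʳ-≤ : ∀ {p q} r → p + r ≤ q + r → p ≤ q
  +-cancelʳ-≤ {p} {q} r le = subst₂ _≤_ (cancel p r) (cancel q r) (+-monoˡ-≤ (- r) le)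
    where
    cancel : ∀ x y → x + y - y ≡ x
    cancel = solve 2 (λ x y → x :+ y :- y := x) refl

  ∣p-q∣≡∣q-p∣ : ∀ p q → ∣ p - q ∣ ≡ ∣ q - p ∣
  ∣p-q∣≡∣q-p∣ p q = trans (sym (∣-p∣≡∣p∣ (p - q))) (cong ∣_∣ (swap p q))
    where
    swap : ∀ p q → - (p - q) ≡ q - p
    swap = solve 2 (λ p q → :- (p :- q) := q :- p) refl

  ∣p-r∣≤∣p-q∣+∣q-r∣ : ∀ p q r → ∣ p - r ∣ ≤ ∣ p - q ∣ + ∣ q - r ∣
  ∣p-r∣≤∣p-q∣+∣q-r∣ p q r =
    subst (λ x → ∣ x ∣ ≤ ∣ p - q ∣ + ∣ q - r ∣) (telescope p q r) (∣p+q∣≤∣p∣+∣q∣ (p - q) (q - r))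
    where
    telescope : ∀ p q r → (p - q) + (q - r) ≡ p - r
    telescope = solve 3 (λ p q r → (p :- q) :+ (q :- r) := p :- r) refl

  ∣q-p∣≤r : ∀ {p q r} → p ≤ q → q ≤ p + r → ∣ q - p ∣ ≤ r
  ∣q-p∣≤r {p} {q} {r} p≤q q≤p+r = subst (_≤ r) (sym (0≤p⇒∣p∣≡p 0≤q-p)) q-p≤r
    where
    p-p≡0 : p - p ≡ 0ℚ
    p-p≡0 = +-inverseʳ p
    0≤q-p : 0ℚ ≤ q - p
    0≤q-p = subst (_≤ q - p) p-p≡0 (+-monoˡ-≤ (- p) p≤q)
    shift : ∀ p r → p + r - p ≡ r
    shift = solve 2 (λ p r → p :+ r :- p := r) refl
    q-p≤r : q - p ≤ r
    q-p≤r = subst (q - p ≤_) (shift p r) (+-monoˡ-≤ (- p) q≤p+r)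

  powℚ-nonNeg : ∀ {u} s → 0ℚ ≤ u → 0ℚ ≤ powℚ u s
  powℚ-nonNeg zero    _   = <⇒≤ (positive⁻¹ 1ℚ)
  powℚ-nonNeg {u} (suc s) 0≤u = nonNegative⁻¹ (u * powℚ u s)
    {{nonNeg*nonNeg⇒nonNeg u {{nonNegative 0≤u}} (powℚ u s) {{nonNegative (powℚ-nonNeg s 0≤u)}}}}

  powℚ-mono-≤ : ∀ {u v} s → 0ℚ ≤ u → u ≤ v → powℚ u s ≤ powℚ v s
  powℚ-mono-≤ zero    _   _   = ≤-refl
  powℚ-mono-≤ {u} {v} (suc s) 0≤u u≤v = ≤-trans
    (*-monoʳ-≤-nonNeg (powℚ u s) {{nonNegative (powℚ-nonNeg s 0≤u)}} u≤v)
    (*-monoˡ-≤-nonNeg v {{nonNegative (≤-trans 0≤u u≤v)}} (powℚ-mono-≤ s 0≤u u≤v))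

module Liouville where

  open import Data.Nat.Base as ℕ using (suc; zero; NonZero)
  import Data.Nat.Properties as ℕ
  open import Data.Nat.Tactic.RingSolver using (solve-∀)
  open import Data.Integer.Base as ℤ using (ℤ; +_)
  import Data.Integer.Properties as ℤ
  open import Data.Rational.Base hiding (NonZero)
  open import Data.Rational.Properties
  open import Defs using (powℚ)
  open Fraction
  open RationalFacts

  fraction-gap : ∀ p q n d .{{_ : NonZero q}} .{{_ : NonZero d}} → p / q ≢ + n / d →
                 (1 /ₙ (q ℕ.* d)) {{ℕ.m*n≢0 q d}} ≤ ∣ p / q - + n / d ∣
  fraction-gap p q n d p/q≢n/d =
    subst (1 /ₙ (q ℕ.* d) ≤_) (sym ∣p/q-n/d∣≡) (/ₙ-≤ 1 ℤ.∣ z ∣ (q ℕ.* d) (q ℕ.* d) 1≤∣z∣)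
    where
    instance _ = ℕ.m*n≢0 q d
    z : ℤ
    z = p ℤ.* + d ℤ.+ (ℤ.- + n) ℤ.* + q
    ∣p/q-n/d∣≡ : ∣ p / q - + n / d ∣ ≡ ℤ.∣ z ∣ /ₙ (q ℕ.* d)
    ∣p/q-n/d∣≡ = trans (cong (λ x → ∣ p / q + x ∣) (-‿/ (+ n) d))
                   (trans (cong ∣_∣ (/-+ p (ℤ.- + n) q d)) (∣/∣ z (q ℕ.* d)))
    z≢0 : ℤ.∣ z ∣ ≢ 0
    z≢0 ∣z∣≡0 = p/q≢n/d (/-≡ p (+ n) q d (ℤ.i-j≡0⇒i≡j _ _ (trans
      (cong (λ x → p ℤ.* + d ℤ.+ x) (ℤ.neg-distribˡ-* (+ n) (+ q))) (ℤ.∣i∣≡0⇒i≡0 ∣z∣≡0))))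
    1≤∣z∣ : 1 ℕ.* (q ℕ.* d) ℕ.≤ ℤ.∣ z ∣ ℕ.* (q ℕ.* d)
    1≤∣z∣ = ℕ.*-monoˡ-≤ (q ℕ.* d) (ℕ.n≢0⇒n>0 z≢0)

  half-gap : ∀ {ε δ} m .{{_ : NonZero m}} →
             1 /ₙ m ≤ ε + δ → δ ≤ (1 /ₙ (2 ℕ.* m)) {{ℕ.m*n≢0 2 m}} → (1 /ₙ (2 ℕ.* m)) {{ℕ.m*n≢0 2 m}} ≤ ε
  half-gap {ε} {δ} m 1/m≤ε+δ δ≤u = +-cancelʳ-≤ u (begin
    u + u    ≡⟨ trans (/ₙ-+-same 1 1 (2 ℕ.* m)) (/ₙ-≡ 2 1 (2 ℕ.* m) m (sym (ℕ.*-identityˡ (2 ℕ.* m)))) ⟩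
    1 /ₙ m   ≤⟨ 1/m≤ε+δ ⟩
    ε + δ    ≤⟨ +-monoʳ-≤ ε δ≤u ⟩
    ε + u    ∎)
    where
    open ≤-Reasoning
    instance _ = ℕ.m*n≢0 2 m
    u = 1 /ₙ (2 ℕ.* m)

  powℚ-1/ₙ : ∀ m .{{_ : NonZero m}} s → powℚ (1 /ₙ m) s ≡ (1 /ₙ m ℕ.^ s) {{ℕ.m^n≢0 m s}}
  powℚ-1/ₙ m zero    = refl
  powℚ-1/ₙ m (suc s) = trans (cong (1 /ₙ m *_) (powℚ-1/ₙ m s)) (/ₙ-* 1 1 m (m ℕ.^ s))
    where instance _ = ℕ.m^n≢0 m s

  power-gap : ∀ {ε} E .{{_ : NonZero E}} s x →
              1 /ₙ E ≤ ε → powℚ ε s * (x /ₙ 1) < 1ℚ → x ℕ.< E ℕ.^ s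
  power-gap {ε} E s x 1/E≤ε εˢx<1 =
    subst₂ ℕ._<_ (ℕ.*-identityʳ x) (ℕ.*-identityˡ (E ℕ.^ s)) (/ₙ-<⁻¹ x 1 (E ℕ.^ s) 1 (begin-strict
      x /ₙ E ℕ.^ s                 ≡⟨ x/Eˢ ⟨
      powℚ (1 /ₙ E) s * (x /ₙ 1)   ≤⟨ *-monoʳ-≤-nonNeg (x /ₙ 1) {{nonNegative (/ₙ-≤ 0 x 1 1 ℕ.z≤n)}}
                                        (powℚ-mono-≤ s (/ₙ-≤ 0 1 1 E ℕ.z≤n) 1/E≤ε) ⟩
      powℚ ε s * (x /ₙ 1)          <⟨ εˢx<1 ⟩
      1ℚ                           ∎))
    where
    open ≤-Reasoning
    instance
      _ = ℕ.m^n≢0 E s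
      _ = ℕ.m*n≢0 (E ℕ.^ s) 1
    regroup : ∀ x y → 1 ℕ.* x ℕ.* y ≡ x ℕ.* (y ℕ.* 1)
    regroup = solve-∀
    x/Eˢ : powℚ (1 /ₙ E) s * (x /ₙ 1) ≡ x /ₙ E ℕ.^ s
    x/Eˢ = trans (cong (_* (x /ₙ 1)) (powℚ-1/ₙ E s)) (trans (/ₙ-* 1 x (E ℕ.^ s) 1)
             (/ₙ-≡ (1 ℕ.* x) x (E ℕ.^ s ℕ.* 1) (E ℕ.^ s) (regroup x (E ℕ.^ s))))

module Growth where

  open import Data.Nat.Base
  open import Data.Nat.Properties
  open import Data.Nat.Tactic.RingSolver using (solve-∀)
  open import Data.Product.Base using (∃-syntax; _×_; _,_)
  open import Relation.Nullary using (yes; no)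

  squaring-selection : (G : ℕ → ℕ) → (∀ k → G (suc k) ≡ G k * G k) → 2 ≤ G 0 →
                       ∀ X → ∃[ k ] X ≤ G k × G (suc k) ≤ G 1 + X ^ 4
  squaring-selection G G-suc 2≤G₀ X = search (<⇒≤ (n<G X))
    where
    2≤G : ∀ n → 2 ≤ G n
    G-nonZero : ∀ n → NonZero (G n)
    G-nonZero n = >-nonZero (≤-trans (s≤s z≤n) (2≤G n))

    2≤G zero    = 2≤G₀
    2≤G (suc n) = subst (2 ≤_) (sym (G-suc n)) (≤-trans (2≤G n) (m≤m*n (G n) (G n) {{G-nonZero n}}))

    n<G : ∀ n → n < G n
    n<G zero    = ≤-trans (s≤s z≤n) (2≤G 0)
    n<G (suc n) = subst (suc n <_) (sym (G-suc n))
      (≤-<-trans (n<G n) (m<m*n (G n) (G n) {{G-nonZero n}} (2≤G n)))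

    -- Walking down from a level with X ≤ G n, we stop at the least such level k; then
    -- G (k - 1) < X, so G (k + 1) = G (k - 1) ^ 4 < X ^ 4.
    search : ∀ {n} → X ≤ G n → ∃[ k ] X ≤ G k × G (suc k) ≤ G 1 + X ^ 4
    search {zero}  X≤G₀ = 0 , X≤G₀ , m≤m+n (G 1) (X ^ 4)
    search {suc n} X≤Gₙ₊₁ with X ≤? G n
    ... | yes X≤Gₙ = search X≤Gₙ
    ... | no  X≰Gₙ = suc n , X≤Gₙ₊₁ , ≤-trans Gₙ₊₂≤X⁴ (m≤n+m (X ^ 4) (G 1))
      where
      Gₙ≤X : G n ≤ X
      Gₙ≤X = <⇒≤ (≰⇒> X≰Gₙ)
      fourth : ∀ x → x * x * (x * x) ≡ x * (x * (x * (x * 1)))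
      fourth = solve-∀
      Gₙ₊₂≤X⁴ : G (suc (suc n)) ≤ X ^ 4
      Gₙ₊₂≤X⁴ = subst₂ _≤_ (sym (trans (G-suc (suc n)) (cong (λ y → y * y) (G-suc n)))) (fourth X)
                         (*-mono-≤ (*-mono-≤ Gₙ≤X Gₙ≤X) (*-mono-≤ Gₙ≤X Gₙ≤X))

  exponent-bound : ∀ {q r s K} → 1 ≤ q → 5 * s < r → q ^ r < (K * q ^ 5) ^ s → q ≤ K ^ s
  exponent-bound {q} {r} {s} {K} 1≤q 5s<r qʳ<[Kq⁵]ˢ =
    <⇒≤ (*-cancelʳ-< (q ^ (5 * s)) q (K ^ s) (begin-strict
    q * q ^ (5 * s)          ≤⟨ ^-monoʳ-≤ q {{>-nonZero 1≤q}} 5s<r ⟩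
    q ^ r                    <⟨ qʳ<[Kq⁵]ˢ ⟩
    (K * q ^ 5) ^ s          ≡⟨ ^-distribʳ-* K (q ^ 5) s ⟩
    K ^ s * (q ^ 5) ^ s      ≡⟨ cong (K ^ s *_) (^-*-assoc q 5 s) ⟩
    K ^ s * q ^ (5 * s)      ∎))
    where
    open ≤-Reasoning
    ^-distribʳ-* : ∀ m n o → (m * n) ^ o ≡ m ^ o * n ^ o
    ^-distribʳ-* m n zero    = refl
    ^-distribʳ-* m n (suc o) =
      trans (cong (m * n *_) (^-distribʳ-* m n o)) (interchange m n (m ^ o) (n ^ o))
      where
      interchange : ∀ m n x y → m * n * (x * y) ≡ m * x * (n * y)
      interchange = solve-∀

module ApproximantAlgebra where

  open import Data.Nat.Base
  open import Data.Nat.Properties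
  open import Data.Nat.Tactic.RingSolver using (solve-∀)

  -- Read in base H with digits α (for A) and γ (for B), sixBlocks is the word A B B A B A and
  -- numer / denom the number 0.A B (B A)^ω, provided e (α + γ) + 1 = H, i.e. α + γ = (H - 1) / e.
  sixBlocks : ℕ → ℕ → ℕ → ℕ
  sixBlocks α γ H = ((((α * H + γ) * H + γ) * H + α) * H + γ) * H + α

  numer : ℕ → ℕ → ℕ → ℕ → ℕ
  numer e α γ H = e * α * H * (H + 1) + e * γ * (H + 2) + 1

  denom : ℕ → ℕ → ℕ
  denom e H = e * (H * H) * suc H

  private
    eliminate : ∀ {x y r s} q → r ≡ s → x + r * q ≡ y + s * q → x ≡ y
    eliminate {x} {y} {r} q refl = +-cancelʳ-≡ (r * q) x y

  numer-sixBlocks : ∀ e α γ H → e * (α + γ) + 1 ≡ H →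
                    numer e α γ H * H ^ 6 ≡ sixBlocks α γ H * denom e H + H * H * (e * γ + 1)
  numer-sixBlocks e α γ H rel = eliminate (H * H * (H * H * H + H * H + H + 1)) rel (identity e α γ H)
    where
    identity : ∀ e α γ H →
      (e * α * H * (H + 1) + e * γ * (H + 2) + 1) * (H * (H * (H * (H * (H * (H * 1))))))
        + (e * (α + γ) + 1) * (H * H * (H * H * H + H * H + H + 1))
        ≡ (((((α * H + γ) * H + γ) * H + α) * H + γ) * H + α) * (e * (H * H) * suc H)
          + H * H * (e * γ + 1) + H * (H * H * (H * H * H + H * H + H + 1))
    identity = solve-∀

  numer-next : ∀ e α γ H → e * (α + γ) + 1 ≡ H →
               numer e α γ H * denom e (H * H) + e * e * (H * H) * α
                 ≡ numer e (α * H + γ) (γ * H + α) (H * H) * denom e H + e * e * (H * H) * γ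
  numer-next e α γ H rel =
    eliminate (e * (H * H) * (H * H * H + H * H + 2 * H + 1)) rel (identity e α γ H)
    where
    identity : ∀ e α γ H →
      (e * α * H * (H + 1) + e * γ * (H + 2) + 1) * (e * (H * H * (H * H)) * suc (H * H))
        + e * e * (H * H) * α + (e * (α + γ) + 1) * (e * (H * H) * (H * H * H + H * H + 2 * H + 1))
        ≡ (e * (α * H + γ) * (H * H) * (H * H + 1) + e * (γ * H + α) * (H * H + 2) + 1)
            * (e * (H * H) * suc H)
          + e * e * (H * H) * γ + H * (e * (H * H) * (H * H * H + H * H + 2 * H + 1))
    identity = solve-∀

  numer-lower : ∀ e α γ H → e * (α + γ) + 1 ≡ H → ∀ c →
                sixBlocks α γ H * c * denom e H ≤ numer e α γ H * c * H ^ 6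
  numer-lower e α γ H rel c = begin
    sixBlocks α γ H * c * denom e H                           ≡⟨ swap (sixBlocks α γ H) c (denom e H) ⟩
    c * (sixBlocks α γ H * denom e H)                         ≤⟨ *-monoʳ-≤ c (m≤m+n _ _) ⟩
    c * (sixBlocks α γ H * denom e H + H * H * (e * γ + 1))   ≡⟨ cong (c *_) (numer-sixBlocks e α γ H rel) ⟨
    c * (numer e α γ H * H ^ 6)                               ≡⟨ swap (numer e α γ H) c (H ^ 6) ⟨
    numer e α γ H * c * H ^ 6                                 ∎
    where
    open ≤-Reasoning
    swap : ∀ x c y → x * c * y ≡ c * (x * y)
    swap = solve-∀

  numer-upper : ∀ e α γ H → e * (α + γ) + 1 ≡ H → ∀ {c} → c ≤ 2 * e →
                numer e α γ H * c * H ^ 6 ≤ (sixBlocks α γ H * c + 2) * denom e H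
  numer-upper e α γ H rel {c} c≤2e = begin
    numer e α γ H * c * H ^ 6                                      ≡⟨ swap (numer e α γ H) c (H ^ 6) ⟩
    c * (numer e α γ H * H ^ 6)                                    ≡⟨ cong (c *_) (numer-sixBlocks e α γ H rel) ⟩
    c * (sixBlocks α γ H * denom e H + H * H * (e * γ + 1))        ≡⟨ *-distribˡ-+ c _ _ ⟩
    c * (sixBlocks α γ H * denom e H) + c * (H * H * (e * γ + 1))  ≤⟨ +-monoʳ-≤ _ overshoot≤ ⟩
    c * (sixBlocks α γ H * denom e H) + 2 * denom e H              ≡⟨ regroup (sixBlocks α γ H) c (denom e H) ⟩
    (sixBlocks α γ H * c + 2) * denom e H                          ∎
    where
    open ≤-Reasoning
    swap : ∀ x c y → x * c * y ≡ c * (x * y)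
    swap = solve-∀
    regroup : ∀ x c d → c * (x * d) + 2 * d ≡ (x * c + 2) * d
    regroup = solve-∀
    eγ+1≤H : e * γ + 1 ≤ H
    eγ+1≤H = subst (e * γ + 1 ≤_) rel (+-monoˡ-≤ 1 (*-monoʳ-≤ e (m≤n+m γ α)))
    overshoot≤ : c * (H * H * (e * γ + 1)) ≤ 2 * denom e H
    overshoot≤ = subst₂ _≤_ (factor c (H * H) (e * γ + 1)) (factor′ e H)
      (*-monoʳ-≤ (H * H) (*-mono-≤ c≤2e (≤-trans eγ+1≤H (n≤1+n H))))
      where
      factor : ∀ c h x → h * (c * x) ≡ c * (h * x)
      factor = solve-∀
      factor′ : ∀ e H → H * H * (2 * e * suc H) ≡ 2 * (e * (H * H) * suc H)
      factor′ = solve-∀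

  denom-≤ : ∀ {e c H} → e < c → e ≤ H → denom e H ≤ c * H ^ 3
  denom-≤ {e} {c} {H} e<c e≤H = begin
    denom e H                                ≡⟨ expand e H ⟩
    e * (H * (H * H)) + e * (H * H)          ≤⟨ +-monoʳ-≤ _ (*-monoˡ-≤ (H * H) e≤H) ⟩
    e * (H * (H * H)) + H * (H * H)          ≡⟨ collect e H ⟩
    suc e * H ^ 3                            ≤⟨ *-monoˡ-≤ (H ^ 3) e<c ⟩
    c * H ^ 3                                ∎
    where
    open ≤-Reasoning
    expand : ∀ e H → e * (H * H) * suc H ≡ e * (H * (H * H)) + e * (H * H)
    expand = solve-∀
    collect : ∀ e H → e * (H * (H * H)) + H * (H * H) ≡ suc e * (H * (H * (H * 1)))
    collect = solve-∀

  numer-cross-≢ : ∀ e α γ H .{{_ : NonZero e}} .{{_ : NonZero H}} → e * (α + γ) + 1 ≡ H → α < γ →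
                  ∀ {α′ γ′ H′} → α′ ≡ α * H + γ → γ′ ≡ γ * H + α → H′ ≡ H * H → ∀ c .{{_ : NonZero c}} →
                  numer e α γ H * c * denom e H′ ≢ numer e α′ γ′ H′ * c * denom e H
  numer-cross-≢ e α γ H rel α<γ refl refl refl c cross = <-irrefl α≡γ α<γ
    where
    instance
      _ = m*n≢0 e e
      _ = m*n≢0 H H
      _ = m*n≢0 (e * e) (H * H)
    swap : ∀ x c y → x * c * y ≡ c * (x * y)
    swap = solve-∀
    cross′ : numer e α γ H * denom e (H * H) ≡ numer e (α * H + γ) (γ * H + α) (H * H) * denom e H
    cross′ = *-cancelˡ-≡ _ _ c (trans (sym (swap (numer e α γ H) c (denom e (H * H))))
               (trans cross (swap (numer e (α * H + γ) (γ * H + α) (H * H)) c (denom e H))))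
    α≡γ : α ≡ γ
    α≡γ = *-cancelˡ-≡ α γ (e * e * (H * H)) (+-cancelˡ-≡ _ _ _
            (trans (cong (_+ e * e * (H * H) * α) (sym cross′)) (numer-next e α γ H rel)))

module ThueMorseBlocks (b : ℕ) .{{_ : ℕ.NonTrivial b}} where

  open import Data.Nat.Base
  open import Data.Nat.Properties
  open import Data.Nat.DivMod
  open import Data.Nat.Tactic.RingSolver using (solve-∀)
  open import Defs using (binDigitSum; thueMorse)
  open BinaryDigitSum using (thueMorse-block)
  open Horner
  open ApproximantAlgebra using (sixBlocks)
  open import Data.Product.Base using (_,_)
  open ≡-Reasoning

  private
    instance
      b-nonZero : NonZero b
      b-nonZero = nonTrivial⇒nonZero b

    [m+n%2]%2 : ∀ m n → (m + n % 2) % 2 ≡ (m + n) % 2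
    [m+n%2]%2 m n = begin
      (m + n % 2) % 2           ≡⟨ %-distribˡ-+ m (n % 2) 2 ⟩
      (m % 2 + n % 2 % 2) % 2   ≡⟨ cong (λ x → (m % 2 + x) % 2) (m%n%n≡m%n n 2) ⟩
      (m % 2 + n % 2) % 2       ≡⟨ %-distribˡ-+ m n 2 ⟨
      (m + n) % 2               ∎

    [2+m]%2 : ∀ m → (2 + m) % 2 ≡ m % 2
    [2+m]%2 m = trans (cong (_% 2) (+-comm 2 m)) ([m+n]%n≡m%n m 2)

    m%2+[1+m]%2≡1 : ∀ m → m % 2 + suc m % 2 ≡ 1
    m%2+[1+m]%2≡1 zero          = refl
    m%2+[1+m]%2≡1 (suc zero)    = refl
    m%2+[1+m]%2≡1 (suc (suc m)) = trans (cong₂ _+_ ([2+m]%2 m) ([2+m]%2 (suc m))) (m%2+[1+m]%2≡1 m)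

  scale : ℕ → ℕ
  scale k = b ^ 2 ^ k

  block : ℕ → ℕ → ℕ
  block k t = horner b (λ i → (t + thueMorse i) % 2) (2 ^ k)

  horner-thueMorse-blocks : ∀ k t n → horner b (λ i → (t + thueMorse i) % 2) (n * 2 ^ k)
                                   ≡ horner (scale k) (λ j → block k (t + thueMorse j)) n
  horner-thueMorse-blocks k t n = trans (horner-blocks b _ (2 ^ k) n)
    (horner-cong (scale k) n (λ {j} _ → horner-cong b (2 ^ k) (digit j)))
    where
    digit : ∀ j {i} → i < 2 ^ k →
            (t + thueMorse (j * 2 ^ k + i)) % 2 ≡ (t + thueMorse j + thueMorse i) % 2
    digit j {i} i<2^k = begin
      (t + thueMorse (j * 2 ^ k + i)) % 2        ≡⟨ cong (λ x → (t + x) % 2) (thueMorse-block k j i<2^k) ⟩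
      (t + (thueMorse j + thueMorse i) % 2) % 2  ≡⟨ [m+n%2]%2 t (thueMorse j + thueMorse i) ⟩
      (t + (thueMorse j + thueMorse i)) % 2      ≡⟨ cong (_% 2) (+-assoc t (thueMorse j) (thueMorse i)) ⟨
      (t + thueMorse j + thueMorse i) % 2        ∎

  α γ : ℕ → ℕ
  α k = block k 0
  γ k = block k 1

  α-suc : ∀ k → α (suc k) ≡ α k * scale k + γ k
  α-suc k = horner-thueMorse-blocks k 0 2

  γ-suc : ∀ k → γ (suc k) ≡ γ k * scale k + α k
  γ-suc k = trans (horner-thueMorse-blocks k 1 2) (cong (γ k * scale k +_) block-2)
    where
    block-2 : block k 2 ≡ α k
    block-2 = horner-cong b (2 ^ k) (λ {i} _ → [2+m]%2 (thueMorse i))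

  scale-suc : ∀ k → scale (suc k) ≡ scale k * scale k
  scale-suc k =
    trans (^-distribˡ-+-* b (2 ^ k) (2 ^ k + 0)) (cong (λ n → scale k * b ^ n) (+-identityʳ (2 ^ k)))

  b≤scale : ∀ k → b ≤ scale k
  b≤scale k = subst (_≤ scale k) (*-identityʳ b) (^-monoʳ-≤ b (m^n>0 2 k))

  α<γ : ∀ k → α k < γ k
  α<γ zero    = ≤-refl
  α<γ (suc k) = subst₂ _<_ (sym (α-suc k)) (sym (γ-suc k))
    (two-digit-< (α<γ k) (≤-trans (nonTrivial⇒n>1 b) (b≤scale k)))
    where
    two-digit-< : ∀ {a c x} → a < c → 2 ≤ x → a * x + c < c * x + a
    two-digit-< {a} {c} {x} a<c 2≤x with m≤n⇒∃[o]m+o≡n a<c | m≤n⇒∃[o]m+o≡n 2≤x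
    ... | o , refl | y , refl = subst (a * (2 + y) + (1 + a + o) <_) (sym (regroup a o y)) (m<m+n _ z<s)
      where
      regroup : ∀ a o y → (1 + a + o) * (2 + y) + a ≡ (a * (2 + y) + (1 + a + o)) + (1 + o) * (1 + y)
      regroup = solve-∀

  α+γ : ∀ k → pred b * (α k + γ k) + 1 ≡ scale k
  α+γ k = begin
    pred b * (α k + γ k) + 1                   ≡⟨ cong (λ x → pred b * x + 1) complementary ⟩
    pred b * horner b (λ _ → 1) (2 ^ k) + 1    ≡⟨ horner-repunit b (2 ^ k) ⟩
    scale k                                    ∎
    where
    complementary : α k + γ k ≡ horner b (λ _ → 1) (2 ^ k)
    complementary =
      trans (horner-+ b _ _ (2 ^ k)) (horner-cong b (2 ^ k) (λ {i} _ → m%2+[1+m]%2≡1 (thueMorse i)))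

  horner-thueMorse-sixBlocks : ∀ k → horner b thueMorse (6 * 2 ^ k) ≡ sixBlocks (α k) (γ k) (scale k)
  horner-thueMorse-sixBlocks k = trans (horner-cong b (6 * 2 ^ k) (λ {i} _ → sym (m%n%n≡m%n (binDigitSum i) 2)))
                                       (horner-thueMorse-blocks k 0 6)

module Expansion (b : ℕ) .{{_ : ℕ.NonTrivial b}} where

  open import Data.Nat.Base as ℕ using (zero; suc; pred; _≤′_; ≤′-refl; ≤′-step)
  import Data.Nat.Properties as ℕ
  open import Data.Nat.Tactic.RingSolver using (solve-∀)
  open import Data.Rational.Base hiding (NonZero)
  open import Data.Rational.Properties
  open import Defs using (thueMorse; invPow; partialSum; tailBound)
  open Fraction
  open RationalFacts
  open Horner using (horner)
  open BinaryDigitSum using (thueMorse-≤1)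

  e : ℕ
  e = pred b

  private
    pred-nonZero : ∀ n .{{_ : ℕ.NonTrivial n}} → NonZero (pred n)
    pred-nonZero (suc (suc n)) = _

  instance
    b-nonZero : NonZero b
    b-nonZero = ℕ.nonTrivial⇒nonZero b

    e-nonZero : NonZero e
    e-nonZero = pred-nonZero b

  b≡1+e : b ≡ suc e
  b≡1+e = sym (ℕ.suc-pred b)

  S T : ℕ → ℚ
  S = partialSum b
  T = tailBound b

  infixl 7 _/b^_

  _/b^_ : ℕ → ℕ → ℚ
  a /b^ N = (a /ₙ b ℕ.^ N) {{ℕ.m^n≢0 b N}}

  invPow≡ : ∀ N → invPow b N ≡ 1 /b^ N
  invPow≡ = invPow-suc b
    where
    invPow-suc : ∀ c .{{_ : NonZero c}} N → invPow c N ≡ (1 /ₙ c ℕ.^ N) {{ℕ.m^n≢0 c N}}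
    invPow-suc (suc c) N = refl

  partialSum≡ : ∀ N → S N ≡ (horner b thueMorse N ℕ.* b) /b^ N
  partialSum≡ zero    = refl
  partialSum≡ (suc N) = begin
    S N + (thueMorse N /ₙ 1) * invPow b N
      ≡⟨ cong₂ (λ x y → x + (thueMorse N /ₙ 1) * y) (partialSum≡ N) (invPow≡ N) ⟩
    (h ℕ.* b) /ₙ P + (thueMorse N /ₙ 1) * (1 /ₙ P)
      ≡⟨ cong ((h ℕ.* b) /ₙ P +_) (/ₙ-* (thueMorse N) 1 1 P) ⟩
    (h ℕ.* b) /ₙ P + (thueMorse N ℕ.* 1) /ₙ (1 ℕ.* P)
      ≡⟨ /ₙ-+-≡ (h ℕ.* b) (thueMorse N ℕ.* 1) ((h ℕ.* b ℕ.+ thueMorse N) ℕ.* b)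
                P (1 ℕ.* P) (b ℕ.* P) (regroup b h (thueMorse N) P) ⟩
    ((h ℕ.* b ℕ.+ thueMorse N) ℕ.* b) /ₙ (b ℕ.* P) ∎
    where
    open ≡-Reasoning
    h = horner b thueMorse N
    P = b ℕ.^ N
    instance
      _ = ℕ.m^n≢0 b N
      _ = ℕ.m*n≢0 1 P
      _ = ℕ.m*n≢0 b P
    regroup : ∀ b h t P → (h ℕ.* b ℕ.* (1 ℕ.* P) ℕ.+ t ℕ.* 1 ℕ.* P) ℕ.* (b ℕ.* P)
                          ≡ (h ℕ.* b ℕ.+ t) ℕ.* b ℕ.* (P ℕ.* (1 ℕ.* P))
    regroup = solve-∀

  tailBound≡ : ∀ N → T N ≡ (b /ₙ e) * (1 /b^ N)
  tailBound≡ = tailBound-2+ b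
    where
    tailBound-2+ : ∀ c .{{_ : ℕ.NonTrivial c}} N → tailBound c N
                   ≡ (c /ₙ pred c) {{pred-nonZero c}} * (1 /ₙ c ℕ.^ N) {{ℕ.m^n≢0 c N {{ℕ.nonTrivial⇒nonZero c}}}}
    tailBound-2+ (suc (suc c)) N = refl

  tailBound-suc : ∀ N → T N ≡ 1 /b^ N + T (suc N)
  tailBound-suc N = begin
    T N                                      ≡⟨ tailBound≡ N ⟩
    (b /ₙ e) * (1 /ₙ P)                      ≡⟨ /ₙ-* b 1 e P ⟩
    (b ℕ.* 1) /ₙ (e ℕ.* P)                   ≡⟨ cong (_/ₙ (e ℕ.* P)) (trans (ℕ.*-identityʳ b) b≡1+e) ⟩
    suc e /ₙ (e ℕ.* P)                       ≡⟨ /ₙ-+-≡ 1 1 (suc e) P (e ℕ.* P) (e ℕ.* P) (ring₁ e P) ⟨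
    1 /ₙ P + 1 /ₙ (e ℕ.* P)                  ≡⟨ cong (1 /ₙ P +_) (/ₙ-≡ 1 (b ℕ.* 1) _ _ (ring₂ b e P)) ⟩
    1 /ₙ P + (b ℕ.* 1) /ₙ (e ℕ.* (b ℕ.* P))  ≡⟨ cong (1 /ₙ P +_) (/ₙ-* b 1 e (b ℕ.* P)) ⟨
    1 /ₙ P + (b /ₙ e) * (1 /ₙ (b ℕ.* P))     ≡⟨ cong (1 /ₙ P +_) (tailBound≡ (suc N)) ⟨
    1 /b^ N + T (suc N)                      ∎
    where
    open ≡-Reasoning
    P = b ℕ.^ N
    instance
      _ = ℕ.m^n≢0 b N
      _ = ℕ.m*n≢0 b P
      _ = ℕ.m*n≢0 e P
      _ = ℕ.m*n≢0 e (b ℕ.* P)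
    ring₁ : ∀ e P → (1 ℕ.* (e ℕ.* P) ℕ.+ 1 ℕ.* P) ℕ.* (e ℕ.* P) ≡ suc e ℕ.* (P ℕ.* (e ℕ.* P))
    ring₁ = solve-∀
    ring₂ : ∀ b e P → 1 ℕ.* (e ℕ.* (b ℕ.* P)) ≡ b ℕ.* 1 ℕ.* (e ℕ.* P)
    ring₂ = solve-∀

  tailBound-nonNeg : ∀ N → 0ℚ ≤ T N
  tailBound-nonNeg N = subst (0ℚ ≤_) (sym (trans (tailBound≡ N) (/ₙ-* b 1 e P)))
                             (/ₙ-≤ 0 (b ℕ.* 1) 1 (e ℕ.* P) ℕ.z≤n)
    where
    P = b ℕ.^ N
    instance
      _ = ℕ.m^n≢0 b N
      _ = ℕ.m*n≢0 e P

  private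
    digit : ℕ → ℚ
    digit N = (thueMorse N /ₙ 1) * invPow b N

    digit≡ : ∀ N → digit N ≡ thueMorse N /b^ N
    digit≡ N = begin
      (t /ₙ 1) * invPow b N       ≡⟨ cong ((t /ₙ 1) *_) (invPow≡ N) ⟩
      (t /ₙ 1) * (1 /ₙ P)         ≡⟨ /ₙ-* t 1 1 P ⟩
      (t ℕ.* 1) /ₙ (1 ℕ.* P)      ≡⟨ /ₙ-≡ (t ℕ.* 1) t (1 ℕ.* P) P (regroup t P) ⟩
      t /ₙ P                      ∎
      where
      open ≡-Reasoning
      t = thueMorse N
      P = b ℕ.^ N
      instance
        _ = ℕ.m^n≢0 b N
        _ = ℕ.m*n≢0 1 P
      regroup : ∀ t P → t ℕ.* 1 ℕ.* P ≡ t ℕ.* (1 ℕ.* P)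
      regroup = solve-∀

    digit-nonNeg : ∀ N → 0ℚ ≤ digit N
    digit-nonNeg N = subst (0ℚ ≤_) (sym (digit≡ N)) (/ₙ-≤ 0 (thueMorse N) 1 (b ℕ.^ N) ℕ.z≤n)
      where instance _ = ℕ.m^n≢0 b N

    digit≤ : ∀ N → digit N ≤ 1 /b^ N
    digit≤ N = subst (_≤ 1 /b^ N) (sym (digit≡ N))
      (/ₙ-≤ (thueMorse N) 1 (b ℕ.^ N) (b ℕ.^ N) (ℕ.*-monoˡ-≤ (b ℕ.^ N) (thueMorse-≤1 N)))
      where instance _ = ℕ.m^n≢0 b N

  partialSum-≤-suc : ∀ N → S N ≤ S (suc N)
  partialSum-≤-suc N = p≤p+q (S N) (digit-nonNeg N)

  partialSum+tailBound-suc-≤ : ∀ N → S (suc N) + T (suc N) ≤ S N + T N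
  partialSum+tailBound-suc-≤ N = begin
    S N + digit N + T (suc N)        ≤⟨ +-monoˡ-≤ (T (suc N)) (+-monoʳ-≤ (S N) (digit≤ N)) ⟩
    S N + 1 /b^ N + T (suc N)        ≡⟨ +-assoc (S N) (1 /b^ N) (T (suc N)) ⟩
    S N + (1 /b^ N + T (suc N))      ≡⟨ cong (S N +_) (tailBound-suc N) ⟨
    S N + T N                        ∎
    where open ≤-Reasoning

  partialSum-mono : ∀ {N M} → N ≤′ M → S N ≤ S M
  partialSum-mono ≤′-refl             = ≤-refl
  partialSum-mono (≤′-step {M} N≤′M) = ≤-trans (partialSum-mono N≤′M) (partialSum-≤-suc M)

  partialSum+tailBound-antitone : ∀ {N M} → N ≤′ M → S M + T M ≤ S N + T N
  partialSum+tailBound-antitone ≤′-refl             = ≤-refl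
  partialSum+tailBound-antitone (≤′-step {M} N≤′M) =
    ≤-trans (partialSum+tailBound-suc-≤ M) (partialSum+tailBound-antitone N≤′M)

  ∣partialSum-partialSum∣≤tailBound : ∀ {N M} → N ℕ.≤ M → ∣ S M - S N ∣ ≤ T N
  ∣partialSum-partialSum∣≤tailBound {N} {M} N≤M = ∣q-p∣≤r (partialSum-mono N≤′M)
    (≤-trans (p≤p+q (S M) (tailBound-nonNeg M)) (partialSum+tailBound-antitone N≤′M))
    where N≤′M = ℕ.≤⇒≤′ N≤M

  e<b : e ℕ.< b
  e<b = ℕ.≤-reflexive (sym b≡1+e)

  b≤2e : b ℕ.≤ 2 ℕ.* e
  b≤2e = subst₂ ℕ._≤_ (sym b≡1+e) (cong (e ℕ.+_) (sym (ℕ.+-identityʳ e)))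
                 (ℕ.+-monoˡ-≤ e (ℕ.n≢0⇒n>0 (ℕ.≢-nonZero⁻¹ e)))

module Approximants (b : ℕ) .{{_ : ℕ.NonTrivial b}} where

  open import Data.Nat.Base as ℕ using (suc; NonZero; _^_)
  import Data.Nat.Properties as ℕ
  open import Data.Rational.Base hiding (NonZero)
  open import Data.Rational.Properties
  open Fraction
  open RationalFacts
  open ApproximantAlgebra
  open ThueMorseBlocks b
  open Expansion b
  open Liouville
  open Horner using (horner)
  open import Defs using (thueMorse; powℚ)
  open import Data.Nat.Tactic.RingSolver using (solve-∀)

  module Stage (k : ℕ) where

    H D n₆ : ℕ
    H  = scale k
    D  = denom e H
    n₆ = 6 ℕ.* 2 ^ k

    instance
      H-nonZero : NonZero H
      H-nonZero = ℕ.m^n≢0 b (2 ^ k)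

      H⁶-nonZero : NonZero (H ^ 6)
      H⁶-nonZero = ℕ.m^n≢0 H 6

      D-nonZero : NonZero D
      D-nonZero = ℕ.m*n≢0 (e ℕ.* (H ℕ.* H)) (suc H) {{ℕ.m*n≢0 e (H ℕ.* H) {{e-nonZero}} {{ℕ.m*n≢0 H H}}}}

    ρ : ℚ
    ρ = (numer e (α k) (γ k) H ℕ.* b) /ₙ D

    V : ℕ
    V = sixBlocks (α k) (γ k) H

    b^n₆≡H⁶ : b ^ n₆ ≡ H ^ 6
    b^n₆≡H⁶ = trans (cong (b ^_) (ℕ.*-comm 6 (2 ^ k))) (sym (ℕ.^-*-assoc b (2 ^ k) 6))

    partialSum-sixBlocks : S n₆ ≡ (V ℕ.* b) /ₙ H ^ 6
    partialSum-sixBlocks = trans (partialSum≡ n₆) (/ₙ-≡ (horner b thueMorse n₆ ℕ.* b) (V ℕ.* b) (b ^ n₆) (H ^ 6)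
      (cong₂ (λ x y → x ℕ.* b ℕ.* y) (horner-thueMorse-sixBlocks k) (sym b^n₆≡H⁶)))
      where instance _ = ℕ.m^n≢0 b n₆

    S[n₆]≤ρ : S n₆ ≤ ρ
    S[n₆]≤ρ = subst (_≤ ρ) (sym partialSum-sixBlocks)
      (/ₙ-≤ (V ℕ.* b) (numer e (α k) (γ k) H ℕ.* b) (H ^ 6) D (numer-lower e (α k) (γ k) H (α+γ k) b))

    ρ≤S[n₆]+2/H⁶ : ρ ≤ S n₆ + 2 /ₙ H ^ 6
    ρ≤S[n₆]+2/H⁶ = subst (ρ ≤_)
      (sym (trans (cong (_+ 2 /ₙ H ^ 6) partialSum-sixBlocks) (/ₙ-+-same (V ℕ.* b) 2 (H ^ 6))))
      (/ₙ-≤ (numer e (α k) (γ k) H ℕ.* b) (V ℕ.* b ℕ.+ 2) D (H ^ 6) (numer-upper e (α k) (γ k) H (α+γ k) b≤2e))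

    T[n₆]≤2/H⁶ : T n₆ ≤ 2 /ₙ H ^ 6
    T[n₆]≤2/H⁶ = subst (_≤ 2 /ₙ H ^ 6) (sym (trans (tailBound≡ n₆) (/ₙ-* b 1 e (b ^ n₆))))
      (/ₙ-≤ (b ℕ.* 1) 2 (e ℕ.* b ^ n₆) (H ^ 6) (begin
        b ℕ.* 1 ℕ.* H ^ 6      ≡⟨ cong (ℕ._* H ^ 6) (ℕ.*-identityʳ b) ⟩
        b ℕ.* H ^ 6            ≤⟨ ℕ.*-monoˡ-≤ (H ^ 6) b≤2e ⟩
        2 ℕ.* e ℕ.* H ^ 6      ≡⟨ ℕ.*-assoc 2 e (H ^ 6) ⟩
        2 ℕ.* (e ℕ.* H ^ 6)    ≡⟨ cong (λ y → 2 ℕ.* (e ℕ.* y)) b^n₆≡H⁶ ⟨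
        2 ℕ.* (e ℕ.* b ^ n₆)   ∎))
      where
      open ℕ.≤-Reasoning
      instance
        _ = ℕ.m^n≢0 b n₆
        _ = ℕ.m*n≢0 e (b ^ n₆)

    ∣x-ρ∣≤ε+4/H⁶ : ∀ x N → ∣ x - ρ ∣ ≤ (∣ S N - x ∣ + T N) + 4 /ₙ H ^ 6
    ∣x-ρ∣≤ε+4/H⁶ x N = ≤-trans (∣p-r∣≤∣p-q∣+∣q-r∣ x (S M) ρ) (+-mono-≤ far near)
      where
      M : ℕ
      M = N ℕ.+ n₆
      far : ∣ x - S M ∣ ≤ ∣ S N - x ∣ + T N
      far = ≤-trans (∣p-r∣≤∣p-q∣+∣q-r∣ x (S N) (S M)) (+-mono-≤ (≤-reflexive (∣p-q∣≡∣q-p∣ x (S N)))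
        (subst (_≤ T N) (∣p-q∣≡∣q-p∣ (S M) (S N)) (∣partialSum-partialSum∣≤tailBound (ℕ.m≤m+n N n₆))))
      ∣S[n₆]-ρ∣≤2/H⁶ : ∣ S n₆ - ρ ∣ ≤ 2 /ₙ H ^ 6
      ∣S[n₆]-ρ∣≤2/H⁶ = subst (_≤ 2 /ₙ H ^ 6) (∣p-q∣≡∣q-p∣ ρ (S n₆)) (∣q-p∣≤r S[n₆]≤ρ ρ≤S[n₆]+2/H⁶)
      near : ∣ S M - ρ ∣ ≤ 4 /ₙ H ^ 6
      near = ≤-trans (∣p-r∣≤∣p-q∣+∣q-r∣ (S M) (S n₆) ρ)
        (subst (∣ S M - S n₆ ∣ + ∣ S n₆ - ρ ∣ ≤_) (/ₙ-+-same 2 2 (H ^ 6))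
          (+-mono-≤ (≤-trans (∣partialSum-partialSum∣≤tailBound (ℕ.m≤n+m n₆ N)) T[n₆]≤2/H⁶) ∣S[n₆]-ρ∣≤2/H⁶))

    -- Liouville: 1 / (q D) ≤ ∣ p / q - ρ ∣ ≤ ε + 4 / H ^ 6, and 4 / H ^ 6 ≤ 1 / (2 q D) because D ≤ b H ^ 3.
    level-bound : ∀ {p q N r s} .{{_ : NonZero q}} → 8 ℕ.* q ℕ.* b ℕ.≤ H ^ 3 → p / q ≢ ρ →
                  powℚ (∣ S N - p / q ∣ + T N) s * (q ^ r /ₙ 1) < 1ℚ →
                  q ^ r ℕ.< (2 ℕ.* (q ℕ.* (b ℕ.* H ^ 3))) ^ s
    level-bound {p} {q} {N} {r} {s} 8qb≤H³ p/q≢ρ close =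
      ℕ.<-≤-trans (power-gap (2 ℕ.* (q ℕ.* D)) s (q ^ r) 1/2qD≤ε close)
                  (ℕ.^-monoˡ-≤ s (ℕ.*-monoʳ-≤ 2 (ℕ.*-monoʳ-≤ q D≤bH³)))
      where
      instance
        _ = ℕ.m*n≢0 q D
        _ = ℕ.m*n≢0 2 (q ℕ.* D)
      D≤bH³ : D ℕ.≤ b ℕ.* H ^ 3
      D≤bH³ = denom-≤ e<b (ℕ.≤-trans (ℕ.<⇒≤ e<b) (b≤scale k))
      8qD≤H⁶ : 4 ℕ.* (2 ℕ.* (q ℕ.* D)) ℕ.≤ 1 ℕ.* H ^ 6
      8qD≤H⁶ = begin
        4 ℕ.* (2 ℕ.* (q ℕ.* D))     ≡⟨ regroup q D ⟩
        8 ℕ.* q ℕ.* D               ≤⟨ ℕ.*-monoʳ-≤ (8 ℕ.* q) D≤bH³ ⟩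
        8 ℕ.* q ℕ.* (b ℕ.* H ^ 3)   ≡⟨ ℕ.*-assoc (8 ℕ.* q) b (H ^ 3) ⟨
        8 ℕ.* q ℕ.* b ℕ.* H ^ 3     ≤⟨ ℕ.*-monoˡ-≤ (H ^ 3) 8qb≤H³ ⟩
        H ^ 3 ℕ.* H ^ 3             ≡⟨ ℕ.^-distribˡ-+-* H 3 3 ⟨
        H ^ 6                       ≡⟨ ℕ.*-identityˡ (H ^ 6) ⟨
        1 ℕ.* H ^ 6                 ∎
        where
        open ℕ.≤-Reasoning
        regroup : ∀ q D → 4 ℕ.* (2 ℕ.* (q ℕ.* D)) ≡ 8 ℕ.* q ℕ.* D
        regroup = solve-∀
      1/2qD≤ε : 1 /ₙ (2 ℕ.* (q ℕ.* D)) ≤ ∣ S N - p / q ∣ + T N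
      1/2qD≤ε = half-gap (q ℕ.* D)
        (≤-trans (fraction-gap p q (numer e (α k) (γ k) H ℕ.* b) D p/q≢ρ) (∣x-ρ∣≤ε+4/H⁶ (p / q) N))
        (/ₙ-≤ 4 1 (H ^ 6) (2 ℕ.* (q ℕ.* D)) 8qD≤H⁶)

  ρ : ℕ → ℚ
  ρ = Stage.ρ

  ρ-≢-suc : ∀ k → ρ k ≢ ρ (suc k)
  ρ-≢-suc k ρₖ≡ρₖ₊₁ =
    numer-cross-≢ e (α k) (γ k) (scale k) {{e-nonZero}} {{H-nonZero k}} (α+γ k) (α<γ k)
                  (α-suc k) (γ-suc k) (scale-suc k) b
      (/ₙ-≡⁻¹ (numer e (α k) (γ k) (scale k) ℕ.* b) (numer e (α (suc k)) (γ (suc k)) (scale (suc k)) ℕ.* b)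
              (D k) (D (suc k)) {{D-nonZero k}} {{D-nonZero (suc k)}} ρₖ≡ρₖ₊₁)
    where open Stage using (D; D-nonZero; H-nonZero)

module Bound (b : ℕ) .{{_ : ℕ.NonTrivial b}} where

  open import Data.Nat.Base hiding (_/_)
  open import Data.Nat.Properties
  open import Data.Nat.Tactic.RingSolver using (solve-∀)
  open import Data.Rational.Base using (_/_)
  import Data.Rational.Properties as ℚ
  open import Data.Product.Base using (∃-syntax; _×_; _,_)
  open import Relation.Nullary using (yes; no)
  open import Defs using (CloseApprox)
  open ThueMorseBlocks b using (scale; scale-suc; b≤scale)
  open Approximants b using (ρ; ρ-≢-suc; module Stage)
  open Growth

  G : ℕ → ℕ
  G k = scale k ^ 3

  G-nonZero : ∀ k → NonZero (G k)
  G-nonZero k = m^n≢0 (scale k) 3 {{m^n≢0 b (2 ^ k) {{nonTrivial⇒nonZero b}}}}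

  G-suc : ∀ k → G (suc k) ≡ G k * G k
  G-suc k = trans (cong (_^ 3) (scale-suc k)) (cube-* (scale k) (scale k))
    where
    cube-* : ∀ x y → (x * y) * ((x * y) * ((x * y) * 1)) ≡ (x * (x * (x * 1))) * (y * (y * (y * 1)))
    cube-* = solve-∀

  2≤G₀ : 2 ≤ G 0
  2≤G₀ = ≤-trans (nonTrivial⇒n>1 b) (≤-trans (b≤scale 0) (m≤m*n (scale 0) (scale 0 ^ 2) {{scale₀²-nonZero}}))
    where
    scale₀²-nonZero : NonZero (scale 0 ^ 2)
    scale₀²-nonZero = m^n≢0 (scale 0) 2 {{m^n≢0 b 1 {{nonTrivial⇒nonZero b}}}}

  G-mono : ∀ {j k} → j ≤ k → G j ≤ G k
  G-mono j≤k = go (≤⇒≤′ j≤k)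
    where
    go : ∀ {j k} → j ≤′ k → G j ≤ G k
    go ≤′-refl           = ≤-refl
    go (≤′-step {k} j≤k) = ≤-trans (go j≤k) (subst (G k ≤_) (sym (G-suc k)) (m≤m*n (G k) (G k) {{G-nonZero k}}))

  K : ℕ
  K = 2 * b * G 1 + 8192 * b ^ 5

  stage-avoiding : ∀ x k → ∃[ j ] k ≤ j × j ≤ suc k × x ≢ ρ j
  stage-avoiding x k with x ℚ.≟ ρ k
  ... | yes x≡ρₖ = suc k , n≤1+n k , ≤-refl , λ x≡ρₖ₊₁ → ρ-≢-suc k (trans (sym x≡ρₖ) x≡ρₖ₊₁)
  ... | no  x≢ρₖ = k , ≤-refl , n≤1+n k , x≢ρₖ

  polynomial-bound : ∀ {q D} → 1 ≤ q → D ≤ G 1 + (8 * q * b) ^ 4 → 2 * (q * (b * D)) ≤ K * q ^ 5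
  polynomial-bound {q} {D} 1≤q D≤ = begin
    2 * (q * (b * D))                            ≤⟨ *-monoʳ-≤ 2 (*-monoʳ-≤ q (*-monoʳ-≤ b D≤)) ⟩
    2 * (q * (b * (G 1 + (8 * q * b) ^ 4)))      ≡⟨ expand q b (G 1) ⟩
    2 * b * G 1 * q + 8192 * b ^ 5 * q ^ 5       ≤⟨ +-monoˡ-≤ _ (*-monoʳ-≤ (2 * b * G 1) q≤q⁵) ⟩
    2 * b * G 1 * q ^ 5 + 8192 * b ^ 5 * q ^ 5   ≡⟨ *-distribʳ-+ (q ^ 5) (2 * b * G 1) (8192 * b ^ 5) ⟨
    K * q ^ 5                                    ∎
    where
    open ≤-Reasoning
    q≤q⁵ : q ≤ q ^ 5
    q≤q⁵ = m≤m*n q (q ^ 4) {{m^n≢0 q 4 {{>-nonZero 1≤q}}}}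
    expand : ∀ q b C → 2 * (q * (b * (C + (8 * q * b) * ((8 * q * b) * ((8 * q * b) * ((8 * q * b) * 1))))))
                       ≡ 2 * b * C * q + 8192 * (b * (b * (b * (b * (b * 1))))) * (q * (q * (q * (q * (q * 1)))))
    expand = solve-∀

  closeApprox-bounded : ∀ {r s} → 5 * s < r → ∀ p q → 1 ≤ q → CloseApprox b r s p q → q ≤ K ^ s
  closeApprox-bounded {r} {s} 5s<r p q@(suc _) 1≤q (N , close)
    with k , X≤Gₖ , Gₖ₊₁≤ ← squaring-selection G G-suc 2≤G₀ (8 * q * b)
    with j , k≤j , j≤k+1 , p/q≢ρⱼ ← stage-avoiding (p / q) k
    = exponent-bound {q} {r} {s} {K} 1≤q 5s<r (<-≤-trans
        (Stage.level-bound j {p} {q} {N} {r} {s} (≤-trans X≤Gₖ (G-mono k≤j)) p/q≢ρⱼ close)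
        (^-monoˡ-≤ s (polynomial-bound {q} {G j} 1≤q (≤-trans (G-mono j≤k+1) Gₖ₊₁≤))))

open import Defs
open import Data.Nat using (ℕ; _≤_; _<_; _*_)
open import Data.Nat.Coprimality using (Coprime)
open import Data.Integer using (ℤ; ∣_∣)
open import Data.Product using (∃; _,_)

theorem8 : (b : ℕ) → 2 ≤ b →
    (r s : ℕ) → 1 ≤ s → 5 * s < r →
    ∃ λ Q → (p : ℤ) (q : ℕ) → 1 ≤ q → Coprime ∣ p ∣ q →
    CloseApprox b r s p q → q ≤ Q
theorem8 b 2≤b r s _ 5s<r = K ^ s , λ p q 1≤q _ → closeApprox-bounded {r} {s} 5s<r p q 1≤q
  where
  instance _ = ℕ.n>1⇒nonTrivial 2≤b
  open Bound b
  open Data.Nat using (_^_)
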